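{- Let $(X,S,G,\mathcal{B})$ be an $n$-dimensional building-like complex and let $\mathcal{C}=\{c_{s,\tau}\in C_{k+1}(B_{s,\tau}): -1\le k\le n-1,\ (s,\tau)\in S\times X(k)\}$ be a family of $\mathbb{F}_2$-chains satisfying $\partial_{k+1}c_{s,\tau}=\tau+\sum_{i=0}^k c_{s,\tau_i}$ for all such $(s,\tau)$, where $\tau=(v_0,\dots,v_k)$ and $\tau_i$ is $\tau$ with $v_i$ removed. For $s\in S$ and $0\le k\le n$ define $\iota_s:C^k(X)\to C^{k-1}(X)$ by $\iota_s\alpha(\tau)=\alpha(c_{s,\tau})$ for $\tau\in X(k-1)$. Then for every $0\le k\le n-1$, every $s\in S$ and every $\alpha\in C^k(X)$, $$d_{k-1}\iota_s\alpha+\iota_s d_k\alpha=\alpha.$$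
   Context: All (co)chains are with $\mathbb{F}_2$ coefficients and the augmented convention is used: $X(-1)=\{\emptyset\}$, $C_{ -1}$ is spanned by the empty simplex with $\partial_0 v=\emptyset$ for every vertex $v$, $C^{ -1}(X)=\mathbb{F}_2^{\{\emptyset\}}$ and $d_{ -1}\psi(v)=\psi(\emptyset)$; a cochain is evaluated on a chain by linearity, and $d_k\alpha(\eta)=\alpha(\partial_{k+1}\eta)$. A building-like complex is a 4-tuple $(X,S,G,\mathcal{B})$ where $X$ is a finite pure $n$-dimensional simplicial complex ($X(k)$ its $k$-faces, $X^{(k)}$ its $k$-skeleton), $G$ is a subgroup of $\mathrm{Aut}(X)$, $S$ is a finite $G$-set, $\mathcal{F}_k=S\times X(k)$ with diagonal $G$-action, and $\mathcal{B}=\{B_{s,\tau}: -1\le k<n,\ (s,\tau)\in\mathcal{F}_k\}$ is a family of subcomplexes with $\tau\in B_{s,\tau}\subset B_{s,\tau'}$ for $s\in S$, $\tau\subset\tau'\in X^{(n-1)}$, satisfying: (C1) $G$ is transitive on $X(n)$; (C2) $gB_{s,\tau}=B_{gs,g\tau}$ for all $g\in G$, $(s,\tau)\in S\times X^{(n-1)}$; (C3) $\tilde H_i(B_{s,\tau};\mathbb{F}_2)=0$ for all $(s,\tau)\in\mathcal{F}_k$, $-1\le i\le k<n$. -}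

module Defs where

open import Data.Nat using (ℕ; zero; suc; _≤_)
open import Data.Bool using (Bool; true; false; T; _∧_; _xor_; if_then_else_)
import Data.Bool as B
open import Data.Fin using (Fin)
open import Data.Fin.Subset using (Subset; ⊥; ⁅_⁆; _⊆_; _∪_; _-_; ∣_∣; inside; outside)
open import Data.Fin.Subset.Properties using (_∈?_)
open import Data.Fin.Permutation using (Permutation′; _⟨$⟩ʳ_; _⟨$⟩ˡ_; id; flip; _∘ₚ_)
open import Data.List using (List; []; _∷_; map; foldr; concatMap)
open import Data.List.Base using (allFin)
open import Data.Vec using (Vec; []; _∷_; tabulate; lookup)
open import Data.Vec.Properties using (≡-dec)
open import Data.Product using (Σ; ∃; _×_)
open import Relation.Nullary.Decidable using (⌊_⌋)
open import Relation.Binary.PropositionalEquality using (_≡_)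

-- F₂ is modelled by Bool: addition = _xor_, multiplication = _∧_.
-- A simplex on vertex set Fin V is a subset of Fin V; a k-simplex has
-- cardinality k+1 (so the empty simplex ⊥ is the unique (-1)-simplex).

Σ₂ : List Bool → Bool
Σ₂ = foldr _xor_ false

allSubsets : (V : ℕ) → List (Subset V)
allSubsets zero = [] ∷ []
allSubsets (suc V) = concatMap (λ s → (outside ∷ s) ∷ (inside ∷ s) ∷ []) (allSubsets V)

-- F₂-chains / cochains: coefficient of each simplex (only the values on
-- the relevant simplices matter; support conditions are stated separately)
Chain : ℕ → Set
Chain V = Subset V → Bool

Cochain : ℕ → Set
Cochain V = Subset V → Bool

single : ∀ {V} → Subset V → Chain V
single σ ρ = ⌊ ≡-dec B._≟_ ρ σ ⌋

-- (augmented) boundary: coefficient of σ in ∂c is the sum of the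
-- coefficients in c of the simplices σ ∪ {v}, v ∉ σ (those having σ as a facet)
∂ : ∀ {V} → Chain V → Chain V
∂ {V} c σ = Σ₂ (map (λ v → if ⌊ v ∈? σ ⌋ then false else c (σ ∪ ⁅ v ⁆)) (allFin V))

⟪_,_⟫ : ∀ {V} → Cochain V → Chain V → Bool
⟪_,_⟫ {V} α c = Σ₂ (map (λ σ → α σ ∧ c σ) (allSubsets V))

d : ∀ {V} → Cochain V → Cochain V
d α η = ⟪ α , ∂ (single η) ⟫

facetSum : ∀ {V} → (Subset V → Chain V) → Subset V → Chain V
facetSum {V} c τ σ = Σ₂ (map (λ v → if ⌊ v ∈? τ ⌋ then c (τ - v) σ else false) (allFin V))

img : ∀ {V} → Permutation′ V → Subset V → Subset V
img g σ = tabulate (λ j → lookup σ (g ⟨$⟩ˡ j))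

-- X : finite simplicial complex with vertex set Fin V (faces given by
--     the Boolean predicate `face`, including the empty face);
-- G : subgroup of Aut(X), given as a predicate on vertex permutations;
-- S : the finite G-set Fin nS with action `act`;
-- B s τ : the subcomplex B_{s,τ} (for τ ∈ X^{(n-1)}, i.e. ∣τ∣ ≤ n).

record BuildingLike (V n : ℕ) : Set₁ where
  field
    face        : Subset V → Bool
    face-empty  : T (face ⊥)
    face-vertex : ∀ v → T (face ⁅ v ⁆)
    face-down   : ∀ σ ρ → ρ ⊆ σ → T (face σ) → T (face ρ)
    dim-bound   : ∀ σ → T (face σ) → ∣ σ ∣ ≤ suc n
    pure        : ∀ σ → T (face σ) → ∃ λ ρ → T (face ρ) × ∣ ρ ∣ ≡ suc n × σ ⊆ ρ
    inG         : Permutation′ V → Set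
    G-ext       : ∀ g h → (∀ v → g ⟨$⟩ʳ v ≡ h ⟨$⟩ʳ v) → inG g → inG h
    G-id        : inG id
    G-comp      : ∀ g h → inG g → inG h → inG (g ∘ₚ h)
    G-inv       : ∀ g → inG g → inG (flip g)
    G-aut       : ∀ g → inG g → ∀ σ → face (img g σ) ≡ face σ
    nS          : ℕ
    act         : Permutation′ V → Fin nS → Fin nS
    act-ext     : ∀ g h → inG g → inG h → (∀ v → g ⟨$⟩ʳ v ≡ h ⟨$⟩ʳ v) → ∀ s → act g s ≡ act h s
    act-id      : ∀ s → act id s ≡ s
    -- (h ∘ₚ g) is the permutation v ↦ g (h v)
    act-comp    : ∀ g h → inG g → inG h → ∀ s → act (h ∘ₚ g) s ≡ act g (act h s)
    B           : Fin nS → Subset V → (Subset V → Bool)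
    B-sub       : ∀ s τ → T (face τ) → ∣ τ ∣ ≤ n → ∀ ρ → T (B s τ ρ) → T (face ρ)
    B-down      : ∀ s τ → T (face τ) → ∣ τ ∣ ≤ n → ∀ σ ρ → ρ ⊆ σ → T (B s τ σ) → T (B s τ ρ)
    B-self      : ∀ s τ → T (face τ) → ∣ τ ∣ ≤ n → T (B s τ τ)
    B-mono      : ∀ s τ τ′ → T (face τ′) → ∣ τ′ ∣ ≤ n → τ ⊆ τ′ → ∀ ρ → T (B s τ ρ) → T (B s τ′ ρ)
    C1          : ∀ σ σ′ → T (face σ) → ∣ σ ∣ ≡ suc n → T (face σ′) → ∣ σ′ ∣ ≡ suc n →
                  ∃ λ g → inG g × img g σ ≡ σ′
    C2          : ∀ g → inG g → ∀ s τ → T (face τ) → ∣ τ ∣ ≤ n →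
                  ∀ ρ → B (act g s) (img g τ) (img g ρ) ≡ B s τ ρ
    -- (C3) H̃_i(B_{s,τ}; F₂) = 0 for -1 ≤ i ≤ k, τ ∈ X(k), k < n:
    -- every i-cycle of B_{s,τ} is the boundary of an (i+1)-chain of B_{s,τ}
    -- (here j = i+1 is the cardinality of i-simplices, 0 ≤ j ≤ ∣τ∣ = k+1)
    C3          : ∀ s τ → T (face τ) → ∣ τ ∣ ≤ n → ∀ j → j ≤ ∣ τ ∣ →
                  ∀ (z : Chain V) → (∀ σ → T (z σ) → T (B s τ σ) × ∣ σ ∣ ≡ j) →
                  (∀ σ → ∂ z σ ≡ false) →
                  ∃ λ (w : Chain V) → (∀ σ → T (w σ) → T (B s τ σ) × ∣ σ ∣ ≡ suc j) ×
                                      (∀ σ → ∂ w σ ≡ z σ)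

open BuildingLike public

record ConeFamily {V n : ℕ} (X : BuildingLike V n) (c : Fin (nS X) → Subset V → Chain V) : Set where
  field
    c-support  : ∀ s τ → T (face X τ) → ∣ τ ∣ ≤ n →
                 ∀ σ → T (c s τ σ) → T (B X s τ σ) × ∣ σ ∣ ≡ suc ∣ τ ∣
    c-boundary : ∀ s τ → T (face X τ) → ∣ τ ∣ ≤ n →
                 ∀ σ → ∂ (c s τ) σ ≡ (single τ σ xor facetSum (c s) τ σ)

ι : ∀ {V} {m : ℕ} → (Fin m → Subset V → Chain V) → Fin m → Cochain V → Cochain V
ι c s α τ = ⟪ α , c s τ ⟫

-- Evaluation of cochains on chains makes d adjoint to ∂, so ι_s(dα)(τ) = α(∂ c_{s,τ}) =
-- α(τ) + Σᵢ α(c_{s,τᵢ}), while d(ι_s α)(τ) = Σᵢ ι_s α(τᵢ) is the same sum Σᵢ α(c_{s,τᵢ});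
-- over F₂ the two copies cancel.
module Submission where

open import Defs
open import Data.Nat using (ℕ; suc; _≤_)
open import Data.Bool using (T; _xor_)
open import Data.Fin using (Fin)
open import Data.Fin.Subset using (Subset; ∣_∣)
open import Relation.Binary.PropositionalEquality using (_≡_)

open import Data.Nat using (zero)
open import Data.Bool using (Bool; true; false; _∧_; _∨_; if_then_else_; _≟_)
open import Data.Bool.Properties
  using ( xor-assoc; xor-comm; xor-same; xor-identityʳ; ∧-comm; ∧-assoc
        ; ∧-zeroʳ; ∧-identityʳ; ∨-identityʳ; ∧-distribˡ-xor; ∧-distribʳ-xor
        ; xor-∧-commutativeRing; if-cong-then)
open import Algebra.Bundles using (CommutativeRing)
open import Algebra.Properties.CommutativeSemigroup
  (CommutativeRing.+-commutativeSemigroup xor-∧-commutativeRing) using (interchange)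
open import Data.Fin using (zero; suc)
open import Data.Fin.Subset using (⊥; ⁅_⁆; _∪_; _─_; _-_; inside; outside)
open import Data.Fin.Subset.Properties using (_∈?_; ∪-identityʳ; p─⊥≡p)
open import Data.List using (List; []; _∷_; map; _++_; concatMap)
open import Data.List.Base using (allFin)
open import Data.Vec using ([]; _∷_)
open import Data.Vec.Properties using (≡-dec)
open import Function.Bundles using (mk⇔)
open import Relation.Nullary.Decidable using (⌊_⌋; does; isYes≗does; ⌊⌋-map′; does-⇔)
open import Relation.Binary.PropositionalEquality
  using (refl; sym; trans; cong; cong₂; module ≡-Reasoning)
open ≡-Reasoning

∑ : ∀ {A : Set} → List A → (A → Bool) → Bool
∑ xs f = Σ₂ (map f xs)

∑-cong : ∀ {A : Set} (xs : List A) {f g : A → Bool} → (∀ x → f x ≡ g x) → ∑ xs f ≡ ∑ xs g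
∑-cong []       f≗g = refl
∑-cong (x ∷ xs) f≗g = cong₂ _xor_ (f≗g x) (∑-cong xs f≗g)

∑-false : ∀ {A : Set} (xs : List A) → ∑ xs (λ _ → false) ≡ false
∑-false []       = refl
∑-false (x ∷ xs) = ∑-false xs

∑-distrib-xor : ∀ {A : Set} (xs : List A) (f g : A → Bool) →
                ∑ xs (λ x → f x xor g x) ≡ ∑ xs f xor ∑ xs g
∑-distrib-xor []       f g = refl
∑-distrib-xor (x ∷ xs) f g =
  trans (cong ((f x xor g x) xor_) (∑-distrib-xor xs f g)) (interchange (f x) (g x) (∑ xs f) (∑ xs g))

∧-distribˡ-∑ : ∀ {A : Set} (xs : List A) b (f : A → Bool) → b ∧ ∑ xs f ≡ ∑ xs (λ x → b ∧ f x)
∧-distribˡ-∑ []       b f = ∧-zeroʳ b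
∧-distribˡ-∑ (x ∷ xs) b f =
  trans (∧-distribˡ-xor b (f x) (∑ xs f)) (cong ((b ∧ f x) xor_) (∧-distribˡ-∑ xs b f))

∧-distribʳ-∑ : ∀ {A : Set} (xs : List A) b (f : A → Bool) → ∑ xs f ∧ b ≡ ∑ xs (λ x → f x ∧ b)
∧-distribʳ-∑ []       b f = refl
∧-distribʳ-∑ (x ∷ xs) b f =
  trans (∧-distribʳ-xor b (f x) (∑ xs f)) (cong ((f x ∧ b) xor_) (∧-distribʳ-∑ xs b f))

∑-comm : ∀ {A C : Set} (xs : List A) (ys : List C) (f : A → C → Bool) →
         ∑ xs (λ x → ∑ ys (f x)) ≡ ∑ ys (λ y → ∑ xs (λ x → f x y))
∑-comm []       ys f = sym (∑-false ys)
∑-comm (x ∷ xs) ys f =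
  trans (cong (∑ ys (f x) xor_) (∑-comm xs ys f)) (sym (∑-distrib-xor ys (f x) _))

∑-++ : ∀ {A : Set} (xs ys : List A) (f : A → Bool) → ∑ (xs ++ ys) f ≡ ∑ xs f xor ∑ ys f
∑-++ []       ys f = refl
∑-++ (x ∷ xs) ys f = trans (cong (f x xor_) (∑-++ xs ys f)) (sym (xor-assoc (f x) (∑ xs f) (∑ ys f)))

∑-concatMap : ∀ {A C : Set} (h : A → List C) (xs : List A) (f : C → Bool) →
              ∑ (concatMap h xs) f ≡ ∑ xs (λ x → ∑ (h x) f)
∑-concatMap h []       f = refl
∑-concatMap h (x ∷ xs) f = trans (∑-++ (h x) _ f) (cong (∑ (h x) f xor_) (∑-concatMap h xs f))

∑-∧-when : ∀ {A : Set} (xs : List A) b (g f : A → Bool) →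
           ∑ xs (λ x → g x ∧ (if b then f x else false)) ≡ (if b then ∑ xs (λ x → g x ∧ f x) else false)
∑-∧-when xs true  g f = refl
∑-∧-when xs false g f = trans (∑-cong xs (λ x → ∧-zeroʳ (g x))) (∑-false xs)

∑-allSubsets-suc : ∀ V (f : Subset (suc V) → Bool) →
                   ∑ (allSubsets (suc V)) f ≡ ∑ (allSubsets V) (λ σ → f (outside ∷ σ) xor f (inside ∷ σ))
∑-allSubsets-suc V f =
  trans (∑-concatMap _ (allSubsets V) f)
        (∑-cong (allSubsets V) (λ σ → cong (f (outside ∷ σ) xor_) (xor-identityʳ (f (inside ∷ σ)))))

single-∷ : ∀ {V} x y (σ τ : Subset V) → single (y ∷ τ) (x ∷ σ) ≡ does (x ≟ y) ∧ single τ σ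
single-∷ x y σ τ =
  trans (isYes≗does _) (cong (does (x ≟ y) ∧_) (sym (isYes≗does (≡-dec _≟_ σ τ))))

single-comm : ∀ {V} (σ ρ : Subset V) → single σ ρ ≡ single ρ σ
single-comm σ ρ = trans (isYes≗does _)
  (trans (does-⇔ (mk⇔ sym sym) (≡-dec _≟_ ρ σ) (≡-dec _≟_ σ ρ)) (sym (isYes≗does _)))

⟪⟫-congʳ : ∀ {V} (α : Cochain V) {c c′ : Chain V} → (∀ σ → c σ ≡ c′ σ) → ⟪ α , c ⟫ ≡ ⟪ α , c′ ⟫
⟪⟫-congʳ {V} α c≗c′ = ∑-cong (allSubsets V) (λ σ → cong (α σ ∧_) (c≗c′ σ))

⟪⟫-xorʳ : ∀ {V} (α : Cochain V) (c c′ : Chain V) →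
          ⟪ α , (λ σ → c σ xor c′ σ) ⟫ ≡ ⟪ α , c ⟫ xor ⟪ α , c′ ⟫
⟪⟫-xorʳ {V} α c c′ =
  trans (∑-cong (allSubsets V) (λ σ → ∧-distribˡ-xor (α σ) (c σ) (c′ σ))) (∑-distrib-xor (allSubsets V) _ _)

⟪⟫-single : ∀ {V} (α : Cochain V) (ρ : Subset V) → ⟪ α , single ρ ⟫ ≡ α ρ
⟪⟫-single {zero}  α []      = trans (xor-identityʳ _) (∧-identityʳ (α []))
⟪⟫-single {suc V} α (x ∷ ρ) =
  trans (∑-allSubsets-suc V _)
        (trans (∑-cong (allSubsets V) (λ σ → sift-head x σ)) (⟪⟫-single (λ σ → α (x ∷ σ)) ρ))
  where
  sift-head : ∀ x σ → α (outside ∷ σ) ∧ single (x ∷ ρ) (outside ∷ σ) xor α (inside ∷ σ) ∧ single (x ∷ ρ) (inside ∷ σ)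
                 ≡ α (x ∷ σ) ∧ single ρ σ
  sift-head false σ rewrite single-∷ outside false σ ρ | single-∷ inside false σ ρ =
    trans (cong (α (outside ∷ σ) ∧ single ρ σ xor_) (∧-zeroʳ (α (inside ∷ σ)))) (xor-identityʳ _)
  sift-head true σ rewrite single-∷ outside true σ ρ | single-∷ inside true σ ρ =
    cong (_xor α (inside ∷ σ) ∧ single ρ σ) (∧-zeroʳ (α (outside ∷ σ)))

⟪⟫-facetSum : ∀ {V} (α : Cochain V) (c : Subset V → Chain V) (τ : Subset V) →
              ⟪ α , facetSum c τ ⟫ ≡ ∑ (allFin V) (λ v → if ⌊ v ∈? τ ⌋ then ⟪ α , c (τ - v) ⟫ else false)
⟪⟫-facetSum {V} α c τ = begin
  ∑ (allSubsets V) (λ ρ → α ρ ∧ ∑ (allFin V) (λ v → if ⌊ v ∈? τ ⌋ then c (τ - v) ρ else false))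
    ≡⟨ ∑-cong (allSubsets V) (λ ρ → ∧-distribˡ-∑ (allFin V) (α ρ) _) ⟩
  ∑ (allSubsets V) (λ ρ → ∑ (allFin V) (λ v → α ρ ∧ (if ⌊ v ∈? τ ⌋ then c (τ - v) ρ else false)))
    ≡⟨ ∑-comm (allSubsets V) (allFin V) _ ⟩
  ∑ (allFin V) (λ v → ∑ (allSubsets V) (λ ρ → α ρ ∧ (if ⌊ v ∈? τ ⌋ then c (τ - v) ρ else false)))
    ≡⟨ ∑-cong (allFin V) (λ v → ∑-∧-when (allSubsets V) ⌊ v ∈? τ ⌋ α (c (τ - v))) ⟩
  ∑ (allFin V) (λ v → if ⌊ v ∈? τ ⌋ then ⟪ α , c (τ - v) ⟫ else false)
    ∎

σ∪⁅v⁆≡τ⇔σ≡τ-v : ∀ {V} (v : Fin V) (σ τ : Subset V) →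
  (if ⌊ v ∈? σ ⌋ then false else single τ (σ ∪ ⁅ v ⁆)) ≡ (if ⌊ v ∈? τ ⌋ then single (τ - v) σ else false)
σ∪⁅v⁆≡τ⇔σ≡τ-v zero (inside  ∷ σ) (inside  ∷ τ) = refl
σ∪⁅v⁆≡τ⇔σ≡τ-v zero (inside  ∷ σ) (outside ∷ τ) = refl
σ∪⁅v⁆≡τ⇔σ≡τ-v zero (outside ∷ σ) (outside ∷ τ) = refl
σ∪⁅v⁆≡τ⇔σ≡τ-v zero (outside ∷ σ) (inside  ∷ τ) = begin
  single (inside ∷ τ) (inside ∷ (σ ∪ ⊥))     ≡⟨ single-∷ inside inside (σ ∪ ⊥) τ ⟩
  single τ (σ ∪ ⊥)                           ≡⟨ cong (single τ) (∪-identityʳ σ) ⟩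
  single τ σ                                 ≡⟨ cong (λ τ′ → single τ′ σ) (p─⊥≡p τ) ⟨
  single (τ ─ ⊥) σ                           ≡⟨ single-∷ outside outside σ (τ ─ ⊥) ⟨
  single (outside ∷ (τ ─ ⊥)) (outside ∷ σ)   ∎
σ∪⁅v⁆≡τ⇔σ≡τ-v (suc v) (a ∷ σ) (b ∷ τ) = begin
  (if ⌊ suc v ∈? a ∷ σ ⌋ then false else single (b ∷ τ) ((a ∨ false) ∷ (σ ∪ ⁅ v ⁆)))
    ≡⟨ cong₂ (λ p x → if p then false else x) (⌊⌋-map′ _ _ (v ∈? σ))
             (trans (single-∷ (a ∨ false) b _ τ) (cong (λ x → does (x ≟ b) ∧ _) (∨-identityʳ a))) ⟩
  (if ⌊ v ∈? σ ⌋ then false else a≟b ∧ single τ (σ ∪ ⁅ v ⁆))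
    ≡⟨ guard-∧ ⌊ v ∈? σ ⌋ ⌊ v ∈? τ ⌋ (σ∪⁅v⁆≡τ⇔σ≡τ-v v σ τ) ⟩
  (if ⌊ v ∈? τ ⌋ then a≟b ∧ single (τ - v) σ else false)
    ≡⟨ sym (cong₂ (λ p x → if p then x else false) (⌊⌋-map′ _ _ (v ∈? τ))
             (single-∷ a b σ (τ - v))) ⟩
  (if ⌊ suc v ∈? b ∷ τ ⌋ then single (b ∷ (τ - v)) (a ∷ σ) else false)
    ∎
  where
  a≟b : Bool
  a≟b = does (a ≟ b)
  guard-∧ : ∀ p q {x y} → (if p then false else x) ≡ (if q then y else false) →
            (if p then false else a≟b ∧ x) ≡ (if q then a≟b ∧ y else false)
  guard-∧ true  true  eq = trans (sym (∧-zeroʳ a≟b)) (cong (a≟b ∧_) eq)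
  guard-∧ true  false eq = refl
  guard-∧ false true  eq = cong (a≟b ∧_) eq
  guard-∧ false false eq = trans (cong (a≟b ∧_) eq) (∧-zeroʳ a≟b)

∂-single : ∀ {V} (τ σ : Subset V) → ∂ (single τ) σ ≡ facetSum single τ σ
∂-single {V} τ σ = ∑-cong (allFin V) (λ v → σ∪⁅v⁆≡τ⇔σ≡τ-v v σ τ)

d-facets : ∀ {V} (α : Cochain V) (τ : Subset V) →
           d α τ ≡ ∑ (allFin V) (λ v → if ⌊ v ∈? τ ⌋ then α (τ - v) else false)
d-facets {V} α τ = begin
  ⟪ α , ∂ (single τ) ⟫           ≡⟨ ⟪⟫-congʳ α (∂-single τ) ⟩
  ⟪ α , facetSum single τ ⟫      ≡⟨ ⟪⟫-facetSum α single τ ⟩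
  ∑ (allFin V) (λ v → if ⌊ v ∈? τ ⌋ then ⟪ α , single (τ - v) ⟫ else false)
    ≡⟨ ∑-cong (allFin V) (λ v → if-cong-then ⌊ v ∈? τ ⌋ (⟪⟫-single α (τ - v))) ⟩
  ∑ (allFin V) (λ v → if ⌊ v ∈? τ ⌋ then α (τ - v) else false)
    ∎

∂-linear : ∀ {V} (c : Chain V) (ρ : Subset V) → ∑ (allSubsets V) (λ σ → ∂ (single σ) ρ ∧ c σ) ≡ ∂ c ρ
∂-linear {V} c ρ = begin
  ∑ (allSubsets V) (λ σ → ∂ (single σ) ρ ∧ c σ)
    ≡⟨ ∑-cong (allSubsets V) (λ σ → ∧-distribʳ-∑ (allFin V) (c σ) _) ⟩
  ∑ (allSubsets V) (λ σ → ∑ (allFin V) (λ v → (if ⌊ v ∈? ρ ⌋ then false else single σ (ρ ∪ ⁅ v ⁆)) ∧ c σ))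
    ≡⟨ ∑-comm (allSubsets V) (allFin V) _ ⟩
  ∑ (allFin V) (λ v → ∑ (allSubsets V) (λ σ → (if ⌊ v ∈? ρ ⌋ then false else single σ (ρ ∪ ⁅ v ⁆)) ∧ c σ))
    ≡⟨ ∑-cong (allFin V) (λ v → coefficient v ⌊ v ∈? ρ ⌋) ⟩
  ∂ c ρ
    ∎
  where
  coefficient : ∀ v b → ∑ (allSubsets V) (λ σ → (if b then false else single σ (ρ ∪ ⁅ v ⁆)) ∧ c σ)
                        ≡ (if b then false else c (ρ ∪ ⁅ v ⁆))
  coefficient v true  = ∑-false (allSubsets V)
  coefficient v false =
    trans (∑-cong (allSubsets V) (λ σ → trans (∧-comm _ (c σ)) (cong (c σ ∧_) (single-comm σ (ρ ∪ ⁅ v ⁆)))))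
          (⟪⟫-single c (ρ ∪ ⁅ v ⁆))

d-adjoint-∂ : ∀ {V} (α : Cochain V) (c : Chain V) → ⟪ d α , c ⟫ ≡ ⟪ α , ∂ c ⟫
d-adjoint-∂ {V} α c = begin
  ∑ SS (λ σ → ∑ SS (λ ρ → α ρ ∧ ∂ (single σ) ρ) ∧ c σ)
    ≡⟨ ∑-cong SS (λ σ → ∧-distribʳ-∑ SS (c σ) _) ⟩
  ∑ SS (λ σ → ∑ SS (λ ρ → (α ρ ∧ ∂ (single σ) ρ) ∧ c σ))
    ≡⟨ ∑-cong SS (λ σ → ∑-cong SS (λ ρ → ∧-assoc (α ρ) _ (c σ))) ⟩
  ∑ SS (λ σ → ∑ SS (λ ρ → α ρ ∧ (∂ (single σ) ρ ∧ c σ)))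
    ≡⟨ ∑-comm SS SS _ ⟩
  ∑ SS (λ ρ → ∑ SS (λ σ → α ρ ∧ (∂ (single σ) ρ ∧ c σ)))
    ≡⟨ ∑-cong SS (λ ρ → trans (sym (∧-distribˡ-∑ SS (α ρ) _)) (cong (α ρ ∧_) (∂-linear c ρ))) ⟩
  ∑ SS (λ ρ → α ρ ∧ ∂ c ρ)
    ∎
  where SS = allSubsets V

cone-homotopy : ∀ {V} (c : Subset V → Chain V) (α : Cochain V) (τ : Subset V) →
                (∀ σ → ∂ (c τ) σ ≡ (single τ σ xor facetSum c τ σ)) →
                (d (λ ρ → ⟪ α , c ρ ⟫) τ xor ⟪ d α , c τ ⟫) ≡ α τ
cone-homotopy c α τ ∂cτ = begin
  d (λ ρ → ⟪ α , c ρ ⟫) τ xor ⟪ d α , c τ ⟫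
    ≡⟨ cong₂ _xor_ (trans (d-facets _ τ) (sym (⟪⟫-facetSum α c τ))) (d-adjoint-∂ α (c τ)) ⟩
  F xor ⟪ α , ∂ (c τ) ⟫
    ≡⟨ cong (F xor_) (trans (⟪⟫-congʳ α ∂cτ) (⟪⟫-xorʳ α (single τ) (facetSum c τ))) ⟩
  F xor (⟪ α , single τ ⟫ xor F)
    ≡⟨ cong (λ x → F xor (x xor F)) (⟪⟫-single α τ) ⟩
  F xor (α τ xor F)
    ≡⟨ cong (F xor_) (xor-comm (α τ) F) ⟩
  F xor (F xor α τ)
    ≡⟨ sym (xor-assoc F F (α τ)) ⟩
  (F xor F) xor α τ
    ≡⟨ cong (_xor α τ) (xor-same F) ⟩
  α τ
    ∎
  where F = ⟪ α , facetSum c τ ⟫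

claim2p2 : ∀ {V n : ℕ} (X : BuildingLike V n) (c : Fin (nS X) → Subset V → Chain V) →
    ConeFamily X c →
    ∀ (s : Fin (nS X)) (α : Cochain V) (τ : Subset V) →
    T (face X τ) → 1 ≤ ∣ τ ∣ → ∣ τ ∣ ≤ n →
    (d (ι c s α) τ xor ι c s (d α) τ) ≡ α τ
claim2p2 X c cone s α τ τ∈X _ ∣τ∣≤n =
  cone-homotopy (c s) α τ (ConeFamily.c-boundary cone s τ τ∈X ∣τ∣≤n)
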